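{- Let $\mathcal{R}$ be a term rewrite system, $\alpha,\beta \in \mathcal{R}$, and let $\vec\delta$ and $\vec\gamma$ be finite sequences of rules of $\mathcal{R}$ with $\vec\delta \sqsupseteq \vec\gamma$. If the precedence constraint $\Phi^\alpha_\beta(\vec\delta)$ is satisfiable, then $\Phi^\alpha_\beta(\vec\gamma)$ is satisfiable.
   Context: Precedence constraints are formulas built from $\top$, $\bot$, $\lor$, $\land$ and atoms $\rho > \rho'$, $\rho \geqslant \rho'$ where $\rho,\rho'$ are rules of $\mathcal{R}$ (treated as variables). A constraint is satisfiable if there is a strict order $>$ on the rules of $\mathcal{R}$ such that the formula is true when $>$ is interpreted by this order and $\geqslant$ by its reflexive closure. The embedding order $\sqsupseteq$ on finite sequences: $(a_1,\dots,a_n) \sqsupseteq (a_{i_1},\dots,a_{i_m})$ whenever $1 \leqslant i_1 < \cdots < i_m \leqslant n$ (subsequence). For a sequence $(\gamma_1,\dots,\gamma_n)$ of rules, \[ \Phi^\alpha_\beta((\gamma_1,\dots,\gamma_n)) \;=\; \bigvee_{1\leqslant i \leqslant n+1}\Bigl(\bigwedge_{j<i} \alpha > \gamma_j \;\land\; \Psi_{i,n}\Bigr), \] where $\Psi_{i,n} = \top$ if $i = n+1$, and for $i \leqslant n$, $\Psi_{i,n} = \beta \geqslant \gamma_i \land \bigwedge_{i<j\leqslant n}(\alpha>\gamma_j \lor \beta>\gamma_j)$ (empty conjunctions are $\top$). -}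

module Defs where

open import Level using (0ℓ)
open import Data.Nat using (ℕ; suc)
open import Data.List using (List; []; _∷_; foldr; map; take; drop; length; upTo)
open import Data.Product using (Σ; _×_)
open import Data.Sum using (_⊎_)
open import Data.Unit using (⊤)
open import Data.Empty using (⊥)
open import Relation.Binary.Core using (Rel)
open import Relation.Binary.Structures using (IsStrictPartialOrder)
open import Relation.Binary.PropositionalEquality using (_≡_)

data Constraint (R : Set) : Set where
  ⊤c ⊥c : Constraint R
  _∨c_ _∧c_ : Constraint R → Constraint R → Constraint R
  _≻_ _≽_ : R → R → Constraint R

infixr 5 _∨c_
infixr 6 _∧c_

⟦_⟧ : {R : Set} → Constraint R → Rel R 0ℓ → Set
⟦ ⊤c ⟧ _>_ = ⊤
⟦ ⊥c ⟧ _>_ = ⊥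
⟦ c ∨c d ⟧ _>_ = ⟦ c ⟧ _>_ ⊎ ⟦ d ⟧ _>_
⟦ c ∧c d ⟧ _>_ = ⟦ c ⟧ _>_ × ⟦ d ⟧ _>_
⟦ a ≻ b ⟧ _>_ = a > b
⟦ a ≽ b ⟧ _>_ = a > b ⊎ a ≡ b

Satisfiable : {R : Set} → Constraint R → Set₁
Satisfiable {R} c =
  Σ (Rel R 0ℓ) λ _>_ → IsStrictPartialOrder _≡_ _>_ × ⟦ c ⟧ _>_

⋀ : {R : Set} → List (Constraint R) → Constraint R
⋀ = foldr _∧c_ ⊤c

⋁ : {R : Set} → List (Constraint R) → Constraint R
⋁ = foldr _∨c_ ⊥c

-- Ψ for 0-based index i (paper's index i+1): the rules γ_{i+1},...,γ_n.
Ψ : {R : Set} → R → R → List R → Constraint R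
Ψ α β [] = ⊤c
Ψ α β (g ∷ rest) = (β ≽ g) ∧c ⋀ (map (λ γ → (α ≻ γ) ∨c (β ≻ γ)) rest)

-- Φ^α_β(γ₁,…,γₙ) = ⋁_{1≤i≤n+1} (⋀_{j<i} α > γ_j ∧ Ψ_{i,n});
-- here i ranges over 0..n (0-based), prefix = take i, suffix = drop i.
Φ : {R : Set} → R → R → List R → Constraint R
Φ α β γs =
  ⋁ (map (λ i → ⋀ (map (α ≻_) (take i γs)) ∧c Ψ α β (drop i γs))
         (upTo (suc (length γs))))

module Submission where

-- Φ^α_β(γ⃗) says that γ⃗ splits as a prefix of rules below α, a pivot γᵢ ⩽ β, and a
-- suffix of rules each below α or below β (or the whole of γ⃗ is below α).  Deleting
-- a rule preserves this shape: the only interesting case is deleting the pivot, and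
-- then the suffix alone, consisting of rules below α or β, already satisfies Φ by
-- pivoting at its first rule that is below β but not known to be below α.  Hence one
-- and the same order satisfies Φ^α_β(δ⃗) and Φ^α_β(γ⃗).

open import Defs
open import Data.List using (List; []; _∷_; map; take; drop; length; upTo)
open import Data.List.Relation.Binary.Sublist.Propositional using (_⊆_; []; _∷_; _∷ʳ_)
open import Data.List.Relation.Binary.Sublist.Propositional.Properties using (All-resp-⊆)
open import Data.List.Relation.Unary.All using (All; []; _∷_)
open import Data.List.Relation.Unary.Any using (Any; here; there; satisfied)
open import Data.List.Membership.Propositional using (lose)
open import Data.List.Membership.Propositional.Properties using (∈-upTo⁺)
open import Data.Nat using (ℕ; zero; suc; _<_; s≤s; z≤n)
open import Data.Product using (∃; _×_; _,_)
open import Data.Sum using (_⊎_; inj₁; inj₂)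
open import Data.Unit using (tt)
open import Level using (0ℓ)
open import Relation.Binary.Core using (Rel)
open import Relation.Binary.PropositionalEquality using (_≡_; refl)

module _ {R A : Set} (_>_ : Rel R 0ℓ) (c : A → Constraint R) where

  ⋀-map⁻ : ∀ xs → ⟦ ⋀ (map c xs) ⟧ _>_ → All (λ x → ⟦ c x ⟧ _>_) xs
  ⋀-map⁻ []       tt         = []
  ⋀-map⁻ (x ∷ xs) (cx , cxs) = cx ∷ ⋀-map⁻ xs cxs

  ⋀-map⁺ : ∀ {xs} → All (λ x → ⟦ c x ⟧ _>_) xs → ⟦ ⋀ (map c xs) ⟧ _>_
  ⋀-map⁺ []         = tt
  ⋀-map⁺ (cx ∷ cxs) = cx , ⋀-map⁺ cxs

  ⋁-map⁻ : ∀ xs → ⟦ ⋁ (map c xs) ⟧ _>_ → Any (λ x → ⟦ c x ⟧ _>_) xs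
  ⋁-map⁻ (x ∷ xs) (inj₁ cx)  = here cx
  ⋁-map⁻ (x ∷ xs) (inj₂ cxs) = there (⋁-map⁻ xs cxs)

  ⋁-map⁺ : ∀ {xs} → Any (λ x → ⟦ c x ⟧ _>_) xs → ⟦ ⋁ (map c xs) ⟧ _>_
  ⋁-map⁺ (here cx)   = inj₁ cx
  ⋁-map⁺ (there cxs) = inj₂ (⋁-map⁺ cxs)

module _ {R : Set} (α β : R) (_>_ : Rel R 0ℓ) where

  Dominated : R → Set
  Dominated γ = α > γ ⊎ β > γ

  data Φ-Holds : List R → Set where
    []    : Φ-Holds []
    pivot : ∀ {γ γs} → β > γ ⊎ β ≡ γ → All Dominated γs → Φ-Holds (γ ∷ γs)
    _∷_   : ∀ {γ γs} → α > γ → Φ-Holds γs → Φ-Holds (γ ∷ γs)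

  All-Dominated⇒Φ-Holds : ∀ {γs} → All Dominated γs → Φ-Holds γs
  All-Dominated⇒Φ-Holds []               = []
  All-Dominated⇒Φ-Holds (inj₁ α>γ ∷ dom) = α>γ ∷ All-Dominated⇒Φ-Holds dom
  All-Dominated⇒Φ-Holds (inj₂ β>γ ∷ dom) = pivot (inj₁ β>γ) dom

  Φ-Holds-resp-⊇ : ∀ {γs δs} → γs ⊆ δs → Φ-Holds δs → Φ-Holds γs
  Φ-Holds-resp-⊇ []           []              = []
  Φ-Holds-resp-⊇ (_ ∷ʳ sub)   (pivot _ dom)   = All-Dominated⇒Φ-Holds (All-resp-⊆ sub dom)
  Φ-Holds-resp-⊇ (_ ∷ʳ sub)   (_ ∷ holds)     = Φ-Holds-resp-⊇ sub holds
  Φ-Holds-resp-⊇ (refl ∷ sub) (pivot β⩾γ dom) = pivot β⩾γ (All-resp-⊆ sub dom)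
  Φ-Holds-resp-⊇ (refl ∷ sub) (α>γ ∷ holds)   = α>γ ∷ Φ-Holds-resp-⊇ sub holds

  disjunct : List R → ℕ → Constraint R
  disjunct γs i = ⋀ (map (α ≻_) (take i γs)) ∧c Ψ α β (drop i γs)

  disjunct⇒Φ-Holds : ∀ γs i → ⟦ disjunct γs i ⟧ _>_ → Φ-Holds γs
  disjunct⇒Φ-Holds []       i       _                  = []
  disjunct⇒Φ-Holds (γ ∷ γs) zero    (_ , β⩾γ , dom)    = pivot β⩾γ (⋀-map⁻ _>_ _ γs dom)
  disjunct⇒Φ-Holds (γ ∷ γs) (suc i) ((α>γ , pre) , ψ) = α>γ ∷ disjunct⇒Φ-Holds γs i (pre , ψ)

  Φ-Holds⇒disjunct : ∀ {γs} → Φ-Holds γs → ∃ λ i → i < suc (length γs) × ⟦ disjunct γs i ⟧ _>_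
  Φ-Holds⇒disjunct []              = zero , s≤s z≤n , tt , tt
  Φ-Holds⇒disjunct (pivot β⩾γ dom) = zero , s≤s z≤n , tt , β⩾γ , ⋀-map⁺ _>_ _ dom
  Φ-Holds⇒disjunct (α>γ ∷ holds) with Φ-Holds⇒disjunct holds
  ... | i , s≤s i≤n , pre , ψ = suc i , s≤s (s≤s i≤n) , (α>γ , pre) , ψ

  ⟦Φ⟧⇒Φ-Holds : ∀ γs → ⟦ Φ α β γs ⟧ _>_ → Φ-Holds γs
  ⟦Φ⟧⇒Φ-Holds γs φ with satisfied (⋁-map⁻ _>_ (disjunct γs) (upTo (suc (length γs))) φ)
  ... | i , d = disjunct⇒Φ-Holds γs i d

  Φ-Holds⇒⟦Φ⟧ : ∀ {γs} → Φ-Holds γs → ⟦ Φ α β γs ⟧ _>_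
  Φ-Holds⇒⟦Φ⟧ holds with Φ-Holds⇒disjunct holds
  ... | i , i≤n , d = ⋁-map⁺ _>_ _ (lose (∈-upTo⁺ i≤n) d)

  ⟦Φ⟧-resp-⊇ : ∀ {γs δs} → γs ⊆ δs → ⟦ Φ α β δs ⟧ _>_ → ⟦ Φ α β γs ⟧ _>_
  ⟦Φ⟧-resp-⊇ sub φ = Φ-Holds⇒⟦Φ⟧ (Φ-Holds-resp-⊇ sub (⟦Φ⟧⇒Φ-Holds _ φ))

lemma5 : {R : Set} (α β : R) (δs γs : List R) →
         γs ⊆ δs → Satisfiable (Φ α β δs) → Satisfiable (Φ α β γs)
lemma5 α β δs γs sub (_>_ , isStrictPartialOrder , φ) =
  _>_ , isStrictPartialOrder , ⟦Φ⟧-resp-⊇ α β _>_ sub φ
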